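{- Let $r\geq 3$ and let $T=C_r\,\square\, C_r$ be the $(r\times r)$-dimensional torus. If $r$ is even, then ${\rm ip}_{c}(T)={\rm ip}_{p}(T)=r$. If $r$ is odd, then ${\rm ip}_{c}(T)\in\{r,r+1\}$ and ${\rm ip}_{p}(T)\in\{r,r+1\}$.
   Context: $C_r$ is the cycle on $r$ vertices and $\square$ the Cartesian product. A path is isometric if its length equals the distance between its endpoints; single vertices count as paths. ${\rm ip}_{c}(H)$ (resp. ${\rm ip}_{p}(H)$) is the minimum number of isometric paths of $H$ whose vertex sets cover (resp. partition) $V(H)$. -}

module Defs where

open import Data.Nat using (ℕ; zero; suc; _≤_; _%_)
open import Data.Fin using (Fin; toℕ)
open import Data.Product using (Σ; _×_; _,_; proj₁; proj₂)
open import Data.Sum using (_⊎_)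
open import Data.Empty using (⊥)
open import Relation.Binary.PropositionalEquality using (_≡_)

record Graph : Set₁ where
  field
    V   : Set
    Adj : V → V → Set
open Graph public

-- The cycle C_r on vertex set Fin r = {0,…,r-1}: i ~ j iff j ≡ i+1 (mod r) or i ≡ j+1 (mod r).
-- (For r ≥ 3 this is exactly the r-cycle.)
CycAdj : (r : ℕ) → Fin r → Fin r → Set
CycAdj zero    i j = ⊥
CycAdj (suc n) i j = (toℕ j ≡ suc (toℕ i) % suc n) ⊎ (toℕ i ≡ suc (toℕ j) % suc n)

Cycle : ℕ → Graph
Cycle r = record { V = Fin r ; Adj = CycAdj r }

_□_ : Graph → Graph → Graph
G □ H = record
  { V   = V G × V H
  ; Adj = λ p q → (proj₁ p ≡ proj₁ q × Adj H (proj₂ p) (proj₂ q))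
                ⊎ (Adj G (proj₁ p) (proj₁ q) × proj₂ p ≡ proj₂ q)
  }

module _ (G : Graph) where

  data Walk : V G → V G → ℕ → Set where
    [_] : (x : V G) → Walk x x 0
    _∷_ : {x y z : V G} {n : ℕ} → Adj G x y → Walk y z n → Walk x z (suc n)

  data _∈W_ (w : V G) : {x z : V G} {n : ℕ} → Walk x z n → Set where
    here-end : {x : V G} → w ≡ x → w ∈W [ x ]
    here     : {x y z : V G} {n : ℕ} {e : Adj G x y} {p : Walk y z n} → w ≡ x → w ∈W (e ∷ p)
    there    : {x y z : V G} {n : ℕ} {e : Adj G x y} {p : Walk y z n} → w ∈W p → w ∈W (e ∷ p)

  -- An isometric path: a walk whose length equals the distance between its endpoints,
  -- i.e. no walk between the endpoints is shorter. (Such a walk is automatically a path;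
  -- single vertices are included as length-0 paths.)
  record IsoPath : Set where
    constructor isoPath
    field
      start end  : V G
      len        : ℕ
      walk       : Walk start end len
      isometric  : (m : ℕ) → Walk start end m → len ≤ m
  open IsoPath public

  OnPath : V G → IsoPath → Set
  OnPath v P = v ∈W walk P

  HasIsoCover : ℕ → Set
  HasIsoCover k = Σ (Fin k → IsoPath) λ P →
    (v : V G) → Σ (Fin k) λ i → OnPath v (P i)

  HasIsoPartition : ℕ → Set
  HasIsoPartition k = Σ (Fin k → IsoPath) λ P →
    ((v : V G) → Σ (Fin k) λ i → OnPath v (P i)) ×
    ((v : V G) (i j : Fin k) → OnPath v (P i) → OnPath v (P j) → i ≡ j)

  IpC≡ : ℕ → Set
  IpC≡ k = HasIsoCover k × ((m : ℕ) → HasIsoCover m → k ≤ m)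

  IpP≡ : ℕ → Set
  IpP≡ k = HasIsoPartition k × ((m : ℕ) → HasIsoPartition m → k ≤ m)

Torus : ℕ → Graph
Torus r = Cycle r □ Cycle r

-- Both values are in fact r, for every r.  Any two vertices of the torus are at distance at most
-- r, so an isometric path has at most r + 1 vertices, and m such paths covering the r² vertices
-- satisfy r² ≤ m (r + 1), whence m ≥ r.  Conversely, r staircases of r − 1 alternating horizontal
-- and vertical steps are isometric (each direction is used at most r/2 times); suitably placed
-- they meet every vertex, and having r² vertices in total they partition the torus.
module Submission where

open import Defs
open import Data.Nat using (ℕ; suc; _≤_)
open import Data.Nat.Divisibility using (_∣_)
open import Relation.Nullary using (¬_)
open import Data.Product using (Σ; _×_)
open import Data.Sum using (_⊎_)
open import Relation.Binary.PropositionalEquality using (_≡_)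

open import Data.Nat using (zero; _+_; _*_; _∸_; _<_; _%_; z≤n; s≤s; NonZero; ⌊_/2⌋; ⌈_/2⌉)
open import Data.Nat.Properties
open import Data.Nat.DivMod using (_mod_; %-distribˡ-+; %-distribˡ-*; m%n%n≡m%n; [m+kn]%n≡m%n; m%n<n; m<n⇒m%n≡m)
open import Algebra.Properties.CommutativeSemigroup +-commutativeSemigroup using (interchange)
  renaming (x∙yz≈y∙xz to x+[y+z]≡y+[x+z])
open import Data.Fin as Fin using (Fin; toℕ; fromℕ<; inject≤; combine; punchOut)
open import Data.Fin.Properties as Finₚ using (toℕ-fromℕ<; toℕ-injective; toℕ<n; inject≤-injective; combine-injective; injective⇒≤; punchOut-injective; *↔×)
  renaming (_≟_ to _≟ᶠ_)
open import Data.Product using (_,_; proj₁; proj₂; Σ-syntax)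
open import Data.Sum using (inj₁; inj₂; swap)
open import Function using (_∘_; Injective; _↔_; Inverse)
open import Level using (0ℓ)
open import Relation.Binary using (IsEquivalence; Setoid)
import Relation.Binary.Reasoning.Setoid
open import Relation.Binary.PropositionalEquality using (refl; sym; trans; cong; cong₂; subst; subst₂; _≢_; module ≡-Reasoning)
open import Relation.Nullary using (yes; no; contradiction)

m+m≤n+n⇒m≤n : ∀ {m n} → m + m ≤ n + n → m ≤ n
m+m≤n+n⇒m≤n {m} {n} m+m≤n+n with m ≤? n
... | yes m≤n = m≤n
... | no  m≰n = contradiction m+m≤n+n (<⇒≱ (+-mono-< (≰⇒> m≰n) (≰⇒> m≰n)))

r*r≤m*[1+r]⇒r≤m : ∀ {m} r → r * r ≤ m * suc r → r ≤ m
r*r≤m*[1+r]⇒r≤m {m} zero    _  = z≤n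
r*r≤m*[1+r]⇒r≤m {m} (suc n) le = ≮⇒≥ λ m<r → <⇒≱ (m*[2+n]<[1+n]*[1+n] m<r) le
  where
  m*[2+n]<[1+n]*[1+n] : m < suc n → m * suc (suc n) < suc n * suc n
  m*[2+n]<[1+n]*[1+n] (s≤s m≤n) = s≤s (≤-trans (*-monoˡ-≤ (suc (suc n)) m≤n) (≤-reflexive (*-suc n (suc n))))

⌊n/2⌋+⌊n/2⌋≤n : ∀ n → ⌊ n /2⌋ + ⌊ n /2⌋ ≤ n
⌊n/2⌋+⌊n/2⌋≤n zero          = z≤n
⌊n/2⌋+⌊n/2⌋≤n (suc zero)    = z≤n
⌊n/2⌋+⌊n/2⌋≤n (suc (suc n)) =
  s≤s (subst (_≤ suc n) (sym (+-suc ⌊ n /2⌋ ⌊ n /2⌋)) (s≤s (⌊n/2⌋+⌊n/2⌋≤n n)))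

1+⌊n/2⌋+u<1+n⇒1+2u≤n : ∀ n u → suc ⌊ n /2⌋ + u < suc n → suc (u + u) ≤ n
1+⌊n/2⌋+u<1+n⇒1+2u≤n n u (s≤s le) = ≤-trans (s≤s (+-monoˡ-≤ u u≤⌊n/2⌋)) le
  where
  1+u≤⌈n/2⌉ : suc u ≤ ⌈ n /2⌉
  1+u≤⌈n/2⌉ = +-cancelˡ-≤ ⌊ n /2⌋ (suc u) ⌈ n /2⌉
    (subst₂ _≤_ (sym (+-suc ⌊ n /2⌋ u)) (sym (⌊n/2⌋+⌈n/2⌉≡n n)) le)
  u≤⌊n/2⌋ : u ≤ ⌊ n /2⌋
  u≤⌊n/2⌋ = ≤-pred (≤-trans 1+u≤⌈n/2⌉ (⌊n/2⌋-mono (n≤1+n (suc n))))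

section⇒injective : ∀ {n} {f g : Fin n → Fin n} → (∀ y → f (g y) ≡ y) → Injective _≡_ _≡_ f
section⇒injective {suc n} {f} {g} fg {a} {b} fa≡fb with a ≟ᶠ b
... | yes a≡b = a≡b
... | no  a≢b = contradiction (injective⇒≤ h-injective) 1+n≰n
  where
  avoid : Fin (suc n) → Fin (suc n)
  avoid p with p ≟ᶠ b
  ... | yes _ = a
  ... | no  _ = p

  b≢avoid : ∀ p → b ≢ avoid p
  b≢avoid p with p ≟ᶠ b
  ... | yes _   = a≢b ∘ sym
  ... | no  p≢b = p≢b ∘ sym

  f∘avoid : ∀ p → f (avoid p) ≡ f p
  f∘avoid p with p ≟ᶠ b
  ... | yes refl = fa≡fb
  ... | no  _    = refl

  h : Fin (suc n) → Fin n
  h k = punchOut (b≢avoid (g k))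

  h-injective : Injective _≡_ _≡_ h
  h-injective {k} {l} e = begin
    k                ≡⟨ sym (fg k) ⟩
    f (g k)          ≡⟨ sym (f∘avoid (g k)) ⟩
    f (avoid (g k))  ≡⟨ cong f (punchOut-injective (b≢avoid (g k)) (b≢avoid (g l)) e) ⟩
    f (avoid (g l))  ≡⟨ f∘avoid (g l) ⟩
    f (g l)          ≡⟨ fg l ⟩
    l                ∎
    where open ≡-Reasoning

module _ {X : Set} {n : ℕ} (Fin↔X : Fin n ↔ X) where
  open Inverse Fin↔X

  ↔-to-injective : Injective _≡_ _≡_ to
  ↔-to-injective {a} {b} e = trans (sym (strictlyInverseʳ a)) (trans (cong from e) (strictlyInverseʳ b))

  ↔-section⇒injective : {f g : X → X} → (∀ x → f (g x) ≡ x) → Injective _≡_ _≡_ f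
  ↔-section⇒injective {f} {g} fg {a} {b} fa≡fb = begin
    a            ≡⟨ strictlyInverseˡ a ⟨
    to (from a)  ≡⟨ cong to (section⇒injective {f = F} {g = G} F∘G≗id F-eq) ⟩
    to (from b)  ≡⟨ strictlyInverseˡ b ⟩
    b            ∎
    where
    open ≡-Reasoning
    F G : Fin n → Fin n
    F = from ∘ f ∘ to
    G = from ∘ g ∘ to
    F∘G≗id : ∀ k → F (G k) ≡ k
    F∘G≗id k = trans (cong (from ∘ f) (strictlyInverseˡ (g (to k)))) (trans (cong from (fg (to k))) (strictlyInverseʳ k))
    F-eq : F (from a) ≡ F (from b)
    F-eq = trans (cong (from ∘ f) (strictlyInverseˡ a)) (trans (cong from fa≡fb) (cong (from ∘ f) (sym (strictlyInverseˡ b))))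

module _ {G : Graph} where

  infixr 5 _++ʷ_
  _++ʷ_ : ∀ {x y z a b} → Walk G x y a → Walk G y z b → Walk G x z (a + b)
  [ _ ]   ++ʷ q = q
  (e ∷ p) ++ʷ q = e ∷ (p ++ʷ q)

  castʷ : ∀ {x x′ z z′ k} → x ≡ x′ → z ≡ z′ → Walk G x z k → Walk G x′ z′ k
  castʷ refl refl w = w

  reverseʷ : (∀ {x y} → Adj G x y → Adj G y x) → ∀ {x y k} → Walk G x y k → Walk G y x k
  reverseʷ sym-adj [ x ] = [ x ]
  reverseʷ sym-adj {x} {k = suc k} (e ∷ w) =
    subst (Walk G _ x) (+-comm k 1) (reverseʷ sym-adj w ++ʷ (sym-adj e ∷ [ x ]))

  shorterWalk : ∀ {x y} f g {r} → f + g ≡ r → Walk G x y f → Walk G x y g →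
                Σ[ l ∈ ℕ ] l + l ≤ r × Walk G x y l
  shorterWalk f g f+g≡r wf wg with ≤-total f g
  ... | inj₁ f≤g = f , subst (f + f ≤_) f+g≡r (+-monoʳ-≤ f f≤g) , wf
  ... | inj₂ g≤f = g , subst (g + g ≤_) (trans (+-comm g f) f+g≡r) (+-monoʳ-≤ g g≤f) , wg

  index : ∀ {v x z k} {p : Walk G x z k} → _∈W_ G v p → Fin (suc k)
  index (here-end _) = Fin.zero
  index (here _)     = Fin.zero
  index (there m)    = Fin.suc (index m)

  index-injective : ∀ {u v x z k} {p : Walk G x z k} (mu : _∈W_ G u p) (mv : _∈W_ G v p) →
                    index mu ≡ index mv → u ≡ v
  index-injective (here-end eu) (here-end ev) _ = trans eu (sym ev)
  index-injective (here eu)     (here ev)     _ = trans eu (sym ev)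
  index-injective (there mu)    (there mv)    e = index-injective mu mv (Finₚ.suc-injective e)

  isoPath-len≤ : ∀ {d} → (∀ u v → Σ[ l ∈ ℕ ] l ≤ d × Walk G u v l) → (P : IsoPath G) → len P ≤ d
  isoPath-len≤ short P with l , l≤d , w ← short (start P) (end P) = ≤-trans (isometric P l w) l≤d

  isoCover-size : ∀ {N d m} {ι : Fin N → V G} → Injective _≡_ _≡_ ι →
                  ((P : IsoPath G) → len P ≤ d) → HasIsoCover G m → N ≤ m * suc d
  isoCover-size {N} {d} {m} {ι} ι-injective len≤d (P , cover) = injective⇒≤ slot-injective
    where
    slot : Fin N → Fin (m * suc d)
    slot k with i , v∈Pᵢ ← cover (ι k) = combine i (inject≤ (index v∈Pᵢ) (s≤s (len≤d (P i))))

    slot-injective : Injective _≡_ _≡_ slot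
    slot-injective {k} {l} e with cover (ι k) | cover (ι l)
    ... | i , mk | j , ml with combine-injective i _ j _ e
    ...   | refl , e′ = ι-injective (index-injective mk ml (inject≤-injective _ _ _ _ e′))

module Modular (r : ℕ) .{{_ : NonZero r}} where

  infix 4 _≈_
  record _≈_ (a b : ℕ) : Set where
    constructor mod-≡
    field %-≡ : a % r ≡ b % r

  ≈-isEquivalence : IsEquivalence _≈_
  ≈-isEquivalence = record
    { refl  = mod-≡ refl
    ; sym   = λ (mod-≡ e) → mod-≡ (sym e)
    ; trans = λ (mod-≡ e) (mod-≡ f) → mod-≡ (trans e f)
    }

  ≈-setoid : Setoid 0ℓ 0ℓ
  ≈-setoid = record { isEquivalence = ≈-isEquivalence }

  module ≈-Reasoning = Relation.Binary.Reasoning.Setoid ≈-setoid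

  open IsEquivalence ≈-isEquivalence public using () renaming (refl to ≈-refl; sym to ≈-sym; trans to ≈-trans)

  m%r≈m : ∀ m → m % r ≈ m
  m%r≈m m = mod-≡ (m%n%n≡m%n m r)

  +-cong : ∀ {a b c d} → a ≈ b → c ≈ d → a + c ≈ b + d
  +-cong {a} {b} {c} {d} (mod-≡ a≈b) (mod-≡ c≈d) = mod-≡ (begin
    (a + c) % r            ≡⟨ %-distribˡ-+ a c r ⟩
    (a % r + c % r) % r    ≡⟨ cong₂ (λ x y → (x + y) % r) a≈b c≈d ⟩
    (b % r + d % r) % r    ≡⟨ %-distribˡ-+ b d r ⟨
    (b + d) % r            ∎)
    where open ≡-Reasoning

  *-congʳ : ∀ {a b} c → a ≈ b → a * c ≈ b * c
  *-congʳ {a} {b} c (mod-≡ a≈b) = mod-≡ (begin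
    (a * c) % r            ≡⟨ %-distribˡ-* a c r ⟩
    (a % r * (c % r)) % r  ≡⟨ cong (λ x → (x * (c % r)) % r) a≈b ⟩
    (b % r * (c % r)) % r  ≡⟨ %-distribˡ-* b c r ⟨
    (b * c) % r            ∎)
    where open ≡-Reasoning

  kr≈0 : ∀ k → k * r ≈ 0
  kr≈0 k = mod-≡ ([m+kn]%n≡m%n 0 k r)

  r≈0 : r ≈ 0
  r≈0 = subst (_≈ 0) (*-identityˡ r) (kr≈0 1)

  m+[r∸m]≈0 : ∀ {m} → m ≤ r → m + (r ∸ m) ≈ 0
  m+[r∸m]≈0 m≤r = subst (_≈ 0) (sym (m+[n∸m]≡n m≤r)) r≈0

  +-cancelˡ-≈ : ∀ a {p q} → a + p ≈ a + q → p ≈ q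
  +-cancelˡ-≈ a {p} {q} a+p≈a+q = begin
    p                        ≈⟨ +-cong (≈-sym ā+a≈0) (≈-refl {p}) ⟩
    (ā + a) + p              ≡⟨ +-assoc ā a p ⟩
    ā + (a + p)              ≈⟨ +-cong (≈-refl {ā}) a+p≈a+q ⟩
    ā + (a + q)              ≡⟨ +-assoc ā a q ⟨
    (ā + a) + q              ≈⟨ +-cong ā+a≈0 (≈-refl {q}) ⟩
    q                        ∎
    where
    open ≈-Reasoning
    ā = r ∸ a % r
    ā+a≈0 : ā + a ≈ 0
    ā+a≈0 = begin
      ā + a        ≈⟨ +-cong (≈-refl {ā}) (≈-sym (m%r≈m a)) ⟩
      ā + a % r    ≡⟨ +-comm ā (a % r) ⟩
      a % r + ā    ≈⟨ m+[r∸m]≈0 (<⇒≤ (m%n<n a r)) ⟩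
      0            ∎

  ≈⇒≡ : ∀ {a b} → a < r → b < r → a ≈ b → a ≡ b
  ≈⇒≡ {a} {b} a<r b<r (mod-≡ e) = trans (sym (m<n⇒m%n≡m a<r)) (trans e (m<n⇒m%n≡m b<r))

  displacement≤steps : ∀ {p q c} → p ≈ c + q → c + c ≤ r → c ≤ p + q
  displacement≤steps {p} {q} {c} p≈c+q c+c≤r with c ≤? p
  ... | yes c≤p = ≤-trans c≤p (m≤m+n p q)
  ... | no  c≰p = ≤-trans (+-cancelˡ-≤ c c q (≤-trans c+c≤r wraps)) (m≤n+m q p)
    where
    wraps : r ≤ c + q
    wraps with r ≤? c + q
    ... | yes r≤c+q = r≤c+q
    ... | no  r≰c+q = contradiction (subst (c ≤_) (sym p≡c+q) (m≤m+n c q)) c≰p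
      where
      p≡c+q : p ≡ c + q
      p≡c+q = ≈⇒≡ (<-≤-trans (≰⇒> c≰p) (≤-trans (m≤m+n c q) (<⇒≤ (≰⇒> r≰c+q)))) (≰⇒> r≰c+q) p≈c+q

-- The cycle C_r, r = n + 1

module CycleOf (n : ℕ) where

  r : ℕ
  r = suc n

  open Modular r public

  C : Graph
  C = Cycle r

  fin : ℕ → Fin r
  fin x = x mod r

  toℕ-fin : ∀ x → toℕ (fin x) ≈ x
  toℕ-fin x = subst (_≈ x) (sym (toℕ-fromℕ< _)) (m%r≈m x)

  fin-cong : ∀ {x y} → x ≈ y → fin x ≡ fin y
  fin-cong (mod-≡ e) = toℕ-injective (trans (toℕ-fromℕ< _) (trans e (sym (toℕ-fromℕ< _))))

  fin-toℕ : (a : Fin r) → fin (toℕ a) ≡ a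
  fin-toℕ a = toℕ-injective (trans (toℕ-fromℕ< _) (m<n⇒m%n≡m (toℕ<n a)))

  fin-suc : ∀ x → toℕ (fin (suc x)) ≡ suc (toℕ (fin x)) % r
  fin-suc x = trans (toℕ-fromℕ< _) (_≈_.%-≡ (+-cong (≈-refl {1}) (≈-sym (toℕ-fin x))))

  forwardWalk : ∀ x k → Walk C (fin x) (fin (k + x)) k
  forwardWalk x zero    = [ fin x ]
  forwardWalk x (suc k) = inj₁ (fin-suc x) ∷ castʷ refl (cong fin (+-suc k x)) (forwardWalk (suc x) k)

  walkOfLength : (a b : Fin r) (d : ℕ) → toℕ a + d ≈ toℕ b → Walk C a b d
  walkOfLength a b d a+d≈b =
    castʷ (fin-toℕ a) (trans (fin-cong (subst (_≈ toℕ b) (+-comm (toℕ a) d) a+d≈b)) (fin-toℕ b))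
          (forwardWalk (toℕ a) d)

  cycle-shortWalk : (a b : Fin r) → Σ[ l ∈ ℕ ] l + l ≤ r × Walk C a b l
  cycle-shortWalk a b =
    shorterWalk d (r ∸ d) (m+[n∸m]≡n d≤r)
      (walkOfLength a b d a+d≈b) (reverseʷ swap (walkOfLength b a (r ∸ d) b+[r∸d]≈a))
    where
    open ≈-Reasoning
    A = toℕ a
    B = toℕ b
    d = (B + (r ∸ A)) % r
    d≤r : d ≤ r
    d≤r = <⇒≤ (m%n<n (B + (r ∸ A)) r)
    a+d≈b : A + d ≈ B
    a+d≈b = begin
      A + d              ≈⟨ +-cong (≈-refl {A}) (m%r≈m (B + (r ∸ A))) ⟩
      A + (B + (r ∸ A))  ≡⟨ x+[y+z]≡y+[x+z] A B (r ∸ A) ⟩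
      B + (A + (r ∸ A))  ≈⟨ +-cong (≈-refl {B}) (m+[r∸m]≈0 (<⇒≤ (toℕ<n a))) ⟩
      B + 0              ≡⟨ +-identityʳ B ⟩
      B                  ∎
    b+[r∸d]≈a : B + (r ∸ d) ≈ A
    b+[r∸d]≈a = begin
      B + (r ∸ d)        ≈⟨ +-cong (≈-sym a+d≈b) (≈-refl {r ∸ d}) ⟩
      A + d + (r ∸ d)    ≡⟨ +-assoc A d (r ∸ d) ⟩
      A + (d + (r ∸ d))  ≈⟨ +-cong (≈-refl {A}) (m+[r∸m]≈0 d≤r) ⟩
      A + 0              ≡⟨ +-identityʳ A ⟩
      A                  ∎

  record Steps (i j : Fin r) (s : ℕ) : Set where
    constructor steps
    field
      forwards backwards : ℕ
      count : forwards + backwards ≡ s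
      net   : toℕ i + forwards ≈ toℕ j + backwards

  steps-[] : ∀ {i} → Steps i i 0
  steps-[] = steps 0 0 refl ≈-refl

  steps-∷ : ∀ {i j k s} → CycAdj r i j → Steps j k s → Steps i k (suc s)
  steps-∷ {i} {j} {k} (inj₁ j≡1+i) (steps p q p+q≡s net) = steps (suc p) q (cong suc p+q≡s) (begin
    toℕ i + suc p          ≡⟨ +-suc (toℕ i) p ⟩
    suc (toℕ i) + p        ≈⟨ +-cong (≈-sym (m%r≈m (suc (toℕ i)))) (≈-refl {p}) ⟩
    suc (toℕ i) % r + p    ≡⟨ cong (_+ p) j≡1+i ⟨
    toℕ j + p              ≈⟨ net ⟩
    toℕ k + q              ∎)
    where open ≈-Reasoning
  steps-∷ {i} {j} {k} (inj₂ i≡1+j) (steps p q p+q≡s net) =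
    steps p (suc q) (trans (+-suc p q) (cong suc p+q≡s)) (begin
    toℕ i + p              ≡⟨ cong (_+ p) i≡1+j ⟩
    suc (toℕ j) % r + p    ≈⟨ +-cong (m%r≈m (suc (toℕ j))) (≈-refl {p}) ⟩
    suc (toℕ j + p)        ≈⟨ +-cong (≈-refl {1}) net ⟩
    suc (toℕ k + q)        ≡⟨ +-suc (toℕ k) q ⟨
    toℕ k + suc q          ∎)
    where open ≈-Reasoning

  steps-lower-bound : ∀ {i j s} c → Steps i j s → toℕ j ≈ toℕ i + c → c + c ≤ r → c ≤ s
  steps-lower-bound {i} {j} c (steps p q refl net) j≈i+c c+c≤r =
    displacement≤steps (+-cancelˡ-≈ (toℕ i) (begin
      toℕ i + p        ≈⟨ net ⟩
      toℕ j + q        ≈⟨ +-cong j≈i+c (≈-refl {q}) ⟩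
      toℕ i + c + q    ≡⟨ +-assoc (toℕ i) c q ⟩
      toℕ i + (c + q)  ∎)) c+c≤r
    where open ≈-Reasoning

module TorusOf (n : ℕ) where

  open CycleOf n public

  T : Graph
  T = Torus r

  Vertex : Set
  Vertex = Fin r × Fin r

  horizontalWalk : ∀ {a b k} → Walk C a b k → (y : Fin r) → Walk T (a , y) (b , y) k
  horizontalWalk [ a ]   y = [ (a , y) ]
  horizontalWalk (e ∷ w) y = inj₂ (e , refl) ∷ horizontalWalk w y

  verticalWalk : ∀ {a b k} (x : Fin r) → Walk C a b k → Walk T (x , a) (x , b) k
  verticalWalk x [ a ]   = [ (x , a) ]
  verticalWalk x (e ∷ w) = inj₁ (refl , e) ∷ verticalWalk x w

  torus-shortWalk : (u v : Vertex) → Σ[ l ∈ ℕ ] l ≤ r × Walk T u v l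
  torus-shortWalk (x₁ , y₁) (x₂ , y₂)
    with l₁ , 2l₁≤r , w₁ ← cycle-shortWalk x₁ x₂
       | l₂ , 2l₂≤r , w₂ ← cycle-shortWalk y₁ y₂ =
    l₁ + l₂ , m+m≤n+n⇒m≤n (subst (_≤ r + r) (interchange l₁ l₁ l₂ l₂) (+-mono-≤ 2l₁≤r 2l₂≤r)) ,
    (horizontalWalk w₁ y₁ ++ʷ verticalWalk x₂ w₂)

  isoCover-lower-bound : ∀ {m} → HasIsoCover T m → r ≤ m
  isoCover-lower-bound cover =
    r*r≤m*[1+r]⇒r≤m r (isoCover-size (↔-to-injective (*↔× {r} {r})) (isoPath-len≤ torus-shortWalk) cover)

  record Projection (u v : Vertex) (k : ℕ) : Set where
    constructor projection
    field
      {horizontal vertical} : ℕ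
      split           : horizontal + vertical ≡ k
      horizontalSteps : Steps (proj₁ u) (proj₁ v) horizontal
      verticalSteps   : Steps (proj₂ u) (proj₂ v) vertical

  project : ∀ {u v k} → Walk T u v k → Projection u v k
  project [ _ ] = projection refl steps-[] steps-[]
  project (inj₁ (refl , e) ∷ w) with projection split hs vs ← project w =
    projection (trans (+-suc _ _) (cong suc split)) hs (steps-∷ e vs)
  project (inj₂ (e , refl) ∷ w) with projection split hs vs ← project w =
    projection (cong suc split) (steps-∷ e hs) vs

  torus-walk-length≥ : ∀ {u v k} cx cy → Walk T u v k →
    toℕ (proj₁ v) ≈ toℕ (proj₁ u) + cx → cx + cx ≤ r →
    toℕ (proj₂ v) ≈ toℕ (proj₂ u) + cy → cy + cy ≤ r → cx + cy ≤ k
  torus-walk-length≥ cx cy w ex 2cx≤r ey 2cy≤r with projection split hs vs ← project w =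
    subst (_ ≤_) split (+-mono-≤ (steps-lower-bound cx hs ex 2cx≤r) (steps-lower-bound cy vs ey 2cy≤r))

  vertex : ℕ × ℕ → Vertex
  vertex (x , y) = fin x , fin y

  pointʳ pointᵘ : ℕ → ℕ → ℕ → ℕ × ℕ
  pointʳ x y zero    = x , y
  pointʳ x y (suc t) = pointᵘ (suc x) y t
  pointᵘ x y zero    = x , y
  pointᵘ x y (suc t) = pointʳ x (suc y) t

  pointʳ-closed : ∀ x y t → pointʳ x y t ≡ (x + ⌈ t /2⌉ , y + ⌊ t /2⌋)
  pointᵘ-closed : ∀ x y t → pointᵘ x y t ≡ (x + ⌊ t /2⌋ , y + ⌈ t /2⌉)
  pointʳ-closed x y zero    = cong₂ _,_ (sym (+-identityʳ x)) (sym (+-identityʳ y))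
  pointʳ-closed x y (suc t) = trans (pointᵘ-closed (suc x) y t) (cong (_, y + ⌈ t /2⌉) (sym (+-suc x ⌊ t /2⌋)))
  pointᵘ-closed x y zero    = cong₂ _,_ (sym (+-identityʳ x)) (sym (+-identityʳ y))
  pointᵘ-closed x y (suc t) = trans (pointʳ-closed x (suc y) t) (cong (x + ⌈ t /2⌉ ,_) (sym (+-suc y ⌊ t /2⌋)))

  staircaseʳ : ∀ x y t → Walk T (vertex (x , y)) (vertex (pointʳ x y t)) t
  staircaseᵘ : ∀ x y t → Walk T (vertex (x , y)) (vertex (pointᵘ x y t)) t
  staircaseʳ x y zero    = [ vertex (x , y) ]
  staircaseʳ x y (suc t) = inj₂ (inj₁ (fin-suc x) , refl) ∷ staircaseᵘ (suc x) y t
  staircaseᵘ x y zero    = [ vertex (x , y) ]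
  staircaseᵘ x y (suc t) = inj₁ (refl , inj₁ (fin-suc y)) ∷ staircaseʳ x (suc y) t

  staircaseʳ-∈ : ∀ x y {t s} → t ≤ s → _∈W_ T (vertex (pointʳ x y t)) (staircaseʳ x y s)
  staircaseᵘ-∈ : ∀ x y {t s} → t ≤ s → _∈W_ T (vertex (pointᵘ x y t)) (staircaseᵘ x y s)
  staircaseʳ-∈ x y {zero}  {zero}  _         = here-end refl
  staircaseʳ-∈ x y {zero}  {suc s} _         = here refl
  staircaseʳ-∈ x y {suc t} {suc s} (s≤s t≤s) = there (staircaseᵘ-∈ (suc x) y t≤s)
  staircaseᵘ-∈ x y {zero}  {zero}  _         = here-end refl
  staircaseᵘ-∈ x y {zero}  {suc s} _         = here refl
  staircaseᵘ-∈ x y {suc t} {suc s} (s≤s t≤s) = there (staircaseʳ-∈ x (suc y) t≤s)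

  ∈staircaseʳ : ∀ x y s {v} (m : _∈W_ T v (staircaseʳ x y s)) → v ≡ vertex (pointʳ x y (toℕ (index m)))
  ∈staircaseᵘ : ∀ x y s {v} (m : _∈W_ T v (staircaseᵘ x y s)) → v ≡ vertex (pointᵘ x y (toℕ (index m)))
  ∈staircaseʳ x y zero    (here-end e) = e
  ∈staircaseʳ x y (suc s) (here e)     = e
  ∈staircaseʳ x y (suc s) (there m)    = ∈staircaseᵘ (suc x) y s m
  ∈staircaseᵘ x y zero    (here-end e) = e
  ∈staircaseᵘ x y (suc s) (here e)     = e
  ∈staircaseᵘ x y (suc s) (there m)    = ∈staircaseʳ x (suc y) s m

  toℕ-fin-shift : ∀ {x z} c → z ≡ x + c → toℕ (fin z) ≈ toℕ (fin x) + c
  toℕ-fin-shift {x} c refl = ≈-trans (toℕ-fin (x + c)) (+-cong (≈-sym (toℕ-fin x)) (≈-refl {c}))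

  -- A staircase of r − 1 steps moves ⌈(r−1)/2⌉ and ⌊(r−1)/2⌋ steps in the two directions,
  -- both at most r/2, so it realises the distance between its ends.
  staircase-isometric : ∀ x y k → Walk T (vertex (x , y)) (vertex (pointʳ x y n)) k → n ≤ k
  staircase-isometric x y k w = subst (_≤ k) (trans (+-comm ⌈ n /2⌉ ⌊ n /2⌋) (⌊n/2⌋+⌈n/2⌉≡n n))
    (torus-walk-length≥ ⌈ n /2⌉ ⌊ n /2⌋ w
      (toℕ-fin-shift ⌈ n /2⌉ (cong proj₁ (pointʳ-closed x y n))) (⌊n/2⌋+⌊n/2⌋≤n (suc n))
      (toℕ-fin-shift ⌊ n /2⌋ (cong proj₂ (pointʳ-closed x y n))) (m≤n⇒m≤1+n (⌊n/2⌋+⌊n/2⌋≤n n)))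

  staircase : ℕ → ℕ → IsoPath T
  staircase x y = isoPath _ _ n (staircaseʳ x y n) (staircase-isometric x y)

  -- The j-th staircase starts at (j + hⱼ , hⱼ), where hⱼ ≡ − j c (mod r) and c = ⌈r/2⌉.  On the
  -- diagonal x − y ≡ d, staircase d contains the c vertices with y − h_d ∈ [0, c) (as its even
  -- vertices) and staircase d − 1 the r − c vertices with y − h_d ∈ [c, r) (as its odd ones).
  c : ℕ
  c = ⌈ r /2⌉

  height : Fin r → ℕ
  height j = (r ∸ toℕ j) * c

  stair : Fin r → IsoPath T
  stair j = staircase (toℕ j + height j) (height j)

  stairVertex : Fin r → ℕ → Vertex
  stairVertex j t = vertex (pointʳ (toℕ j + height j) (height j) t)

  stairVertex-≡ : ∀ j t {x y} → toℕ j + height j + ⌈ t /2⌉ ≈ toℕ x → height j + ⌊ t /2⌋ ≈ toℕ y →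
                  stairVertex j t ≡ (x , y)
  stairVertex-≡ j t {x} {y} ex ey = trans (cong vertex (pointʳ-closed (toℕ j + height j) (height j) t))
    (cong₂ _,_ (trans (fin-cong ex) (fin-toℕ x)) (trans (fin-cong ey) (fin-toℕ y)))

  height+jc≈0 : ∀ j → height j + toℕ j * c ≈ 0
  height+jc≈0 j = subst (_≈ 0) (begin
    c * r                       ≡⟨ *-comm c r ⟩
    r * c                       ≡⟨ cong (_* c) (m∸n+n≡m (<⇒≤ (toℕ<n j))) ⟨
    (r ∸ toℕ j + toℕ j) * c     ≡⟨ *-distribʳ-+ c (r ∸ toℕ j) (toℕ j) ⟩
    height j + toℕ j * c        ∎) (kr≈0 c)
    where open ≡-Reasoning

  previous : Fin r → Fin r
  previous j = fin (toℕ j + n)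

  1+previous≈ : ∀ j → suc (toℕ (previous j)) ≈ toℕ j
  1+previous≈ j = begin
    suc (toℕ (previous j))  ≈⟨ +-cong (≈-refl {1}) (toℕ-fin (toℕ j + n)) ⟩
    suc (toℕ j + n)         ≡⟨ +-suc (toℕ j) n ⟨
    toℕ j + r               ≈⟨ +-cong (≈-refl {toℕ j}) r≈0 ⟩
    toℕ j + 0               ≡⟨ +-identityʳ (toℕ j) ⟩
    toℕ j                   ∎
    where open ≈-Reasoning

  height-previous : ∀ j → height (previous j) ≈ height j + c
  height-previous j = +-cancelˡ-≈ (toℕ i * c) (begin
    toℕ i * c + height i        ≡⟨ +-comm (toℕ i * c) (height i) ⟩
    height i + toℕ i * c        ≈⟨ height+jc≈0 i ⟩
    0                           ≈⟨ ≈-sym (height+jc≈0 j) ⟩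
    height j + toℕ j * c        ≈⟨ +-cong (≈-refl {height j}) (*-congʳ c (≈-sym (1+previous≈ j))) ⟩
    height j + (c + toℕ i * c)  ≡⟨ +-assoc (height j) c (toℕ i * c) ⟨
    height j + c + toℕ i * c    ≡⟨ +-comm (height j + c) (toℕ i * c) ⟩
    toℕ i * c + (height j + c)  ∎)
    where
    open ≈-Reasoning
    i = previous j

  rise : Fin r → Fin r → ℕ
  rise j y = (toℕ y + toℕ j * c) % r

  height+rise≈ : ∀ j y → height j + rise j y ≈ toℕ y
  height+rise≈ j y = begin
    height j + rise j y                 ≈⟨ +-cong (≈-refl {height j}) (m%r≈m (toℕ y + toℕ j * c)) ⟩
    height j + (toℕ y + toℕ j * c)      ≡⟨ x+[y+z]≡y+[x+z] (height j) (toℕ y) (toℕ j * c) ⟩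
    toℕ y + (height j + toℕ j * c)      ≈⟨ +-cong (≈-refl {toℕ y}) (height+jc≈0 j) ⟩
    toℕ y + 0                           ≡⟨ +-identityʳ (toℕ y) ⟩
    toℕ y                               ∎
    where open ≈-Reasoning

  locateOnDiagonal : ∀ j {x y} → toℕ j + toℕ y ≈ toℕ x →
                     Σ[ i ∈ Fin r ] Σ[ t ∈ ℕ ] t ≤ n × stairVertex i t ≡ (x , y)
  locateOnDiagonal j {x} {y} diag with rise j y <? c
  ... | yes w<c = j , w + w , ≤-trans (+-mono-≤ w≤⌊n/2⌋ w≤⌊n/2⌋) (⌊n/2⌋+⌊n/2⌋≤n n) ,
                  stairVertex-≡ j (w + w) ex ey
    where
    open ≈-Reasoning
    w = rise j y
    w≤⌊n/2⌋ : w ≤ ⌊ n /2⌋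
    w≤⌊n/2⌋ = ≤-pred w<c
    ey : height j + ⌊ w + w /2⌋ ≈ toℕ y
    ey = subst (λ h → height j + h ≈ toℕ y) (n≡⌊n+n/2⌋ w) (height+rise≈ j y)
    ex : toℕ j + height j + ⌈ w + w /2⌉ ≈ toℕ x
    ex = begin
      toℕ j + height j + ⌈ w + w /2⌉  ≡⟨ cong (toℕ j + height j +_) (n≡⌈n+n/2⌉ w) ⟨
      toℕ j + height j + w            ≡⟨ +-assoc (toℕ j) (height j) w ⟩
      toℕ j + (height j + w)          ≈⟨ +-cong (≈-refl {toℕ j}) (height+rise≈ j y) ⟩
      toℕ j + toℕ y                   ≈⟨ diag ⟩
      toℕ x                           ∎
  ... | no w≮c with u , c+u≡w ← m≤n⇒∃[o]m+o≡n (≮⇒≥ w≮c) =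
    i , suc (u + u) , 1+⌊n/2⌋+u<1+n⇒1+2u≤n n u (subst (_< r) (sym c+u≡w) (m%n<n (toℕ y + toℕ j * c) r)) ,
    stairVertex-≡ i (suc (u + u)) ex (subst (λ h → height i + h ≈ toℕ y) (n≡⌈n+n/2⌉ u) ey)
    where
    open ≈-Reasoning
    i = previous j
    ey : height i + u ≈ toℕ y
    ey = begin
      height i + u          ≈⟨ +-cong (height-previous j) (≈-refl {u}) ⟩
      height j + c + u      ≡⟨ +-assoc (height j) c u ⟩
      height j + (c + u)    ≡⟨ cong (height j +_) c+u≡w ⟩
      height j + rise j y   ≈⟨ height+rise≈ j y ⟩
      toℕ y                 ∎
    ex : toℕ i + height i + suc ⌊ u + u /2⌋ ≈ toℕ x
    ex = begin
      toℕ i + height i + suc ⌊ u + u /2⌋  ≡⟨ cong (λ h → toℕ i + height i + suc h) (n≡⌊n+n/2⌋ u) ⟨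
      toℕ i + height i + suc u            ≡⟨ trans (+-suc (toℕ i + height i) u) (cong suc (+-assoc (toℕ i) (height i) u)) ⟩
      suc (toℕ i) + (height i + u)        ≈⟨ +-cong (1+previous≈ j) ey ⟩
      toℕ j + toℕ y                       ≈⟨ diag ⟩
      toℕ x                               ∎

  locate : (v : Vertex) → Σ[ j ∈ Fin r ] Σ[ t ∈ ℕ ] t ≤ n × stairVertex j t ≡ v
  locate (x , y) = locateOnDiagonal (fin (X + (r ∸ Y))) (begin
    toℕ (fin (X + (r ∸ Y))) + Y  ≈⟨ +-cong (toℕ-fin (X + (r ∸ Y))) (≈-refl {Y}) ⟩
    X + (r ∸ Y) + Y              ≡⟨ +-assoc X (r ∸ Y) Y ⟩
    X + (r ∸ Y + Y)              ≡⟨ cong (X +_) (m∸n+n≡m (<⇒≤ (toℕ<n y))) ⟩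
    X + r                        ≈⟨ +-cong (≈-refl {X}) r≈0 ⟩
    X + 0                        ≡⟨ +-identityʳ X ⟩
    X                            ∎)
    where
    open ≈-Reasoning
    X = toℕ x
    Y = toℕ y

  enumerate : Vertex → Vertex
  enumerate (j , t) = stairVertex j (toℕ t)

  position : Vertex → Vertex
  position v with j , t , t≤n , _ ← locate v = j , fromℕ< (s≤s t≤n)

  enumerate∘position : ∀ v → enumerate (position v) ≡ v
  enumerate∘position v with j , t , t≤n , e ← locate v = trans (cong (stairVertex j) (toℕ-fromℕ< (s≤s t≤n))) e

  -- The r staircases have r² vertex slots in total and meet all r² vertices, so they never overlap.
  enumerate-injective : Injective _≡_ _≡_ enumerate
  enumerate-injective = ↔-section⇒injective (*↔× {r} {r}) {g = position} enumerate∘position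

  stairs-partition : HasIsoPartition T r
  stairs-partition = stair , covers , disjoint
    where
    covers : (v : Vertex) → Σ[ j ∈ Fin r ] OnPath T v (stair j)
    covers v with j , t , t≤n , e ← locate v = j , subst (λ w → OnPath T w (stair j)) e (staircaseʳ-∈ _ _ t≤n)
    disjoint : (v : Vertex) (i j : Fin r) → OnPath T v (stair i) → OnPath T v (stair j) → i ≡ j
    disjoint v i j v∈i v∈j = cong proj₁ (enumerate-injective {i , index v∈i} {j , index v∈j}
      (trans (sym (∈staircaseʳ (toℕ i + height i) (height i) n v∈i)) (∈staircaseʳ (toℕ j + height j) (height j) n v∈j)))

  torus-ipC : IpC≡ T r
  torus-ipC = (stair , proj₁ (proj₂ stairs-partition)) , λ _ → isoCover-lower-bound

  torus-ipP : IpP≡ T r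
  torus-ipP = stairs-partition , λ { _ (P , cover , _) → isoCover-lower-bound (P , cover) }

theorem8 : (r : ℕ) → 3 ≤ r →
    (2 ∣ r → IpC≡ (Torus r) r × IpP≡ (Torus r) r) ×
    (¬ (2 ∣ r) → (Σ ℕ λ k → (k ≡ r ⊎ k ≡ suc r) × IpC≡ (Torus r) k) ×
             (Σ ℕ λ k → (k ≡ r ⊎ k ≡ suc r) × IpP≡ (Torus r) k))
theorem8 (suc n) _ =
  (λ _ → torus-ipC , torus-ipP) , (λ _ → (suc n , inj₁ refl , torus-ipC) , (suc n , inj₁ refl , torus-ipP))
  where open TorusOf n
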